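{- A positive one-step $\Lambda$-formula $\phi$ over a set $V$ of propositional variables is materializable (i.e. there is a one-step model $(X,\tau,t)$ over $V$ such that for all $\heartsuit\in\Lambda$ and $\rho\in\mathsf{Pos}(V)$, $(X,\tau,t)\models\heartsuit\rho$ iff $\phi\sqsubseteq_1\heartsuit\rho$, and $(X,\tau,t)\models\phi$) if and only if $\phi$ is strongly convex, i.e. $\phi$ is satisfiable in some one-step model over $V$ and whenever $\phi\sqsubseteq_1\bigvee_{i\in I}\psi_i$ for positive one-step $\Lambda$-formulas $\psi_i$ over $V$ and a (possibly infinite) index set $I$, then $\phi\sqsubseteq_1\psi_i$ for some $i\in I$.
   Context: Fix an endofunctor $T$ on sets, non-trivial and preserving subsets. $\Lambda$ is a set of modal operators $\heartsuit$, each with a monotone natural predicate lifting $[\![\heartsuit]\!]_X:\mathcal P(X)\to\mathcal P(TX)$; write $t\models\heartsuit A$ for $t\in[\![\heartsuit]\!]_X(A)$. $\mathsf{Pos}(Z)$ denotes positive propositional formulas over $Z$ (with $\top,\bot,\wedge,\vee$), $\Lambda(Z)=\{\heartsuit z\}$. A one-step model over $V$ is $(X,\tau,t)$ with $X$ a set, $\tau:V\to\mathcal P(X)$, $t\in TX$; $[\![\rho]\!]_\tau\subseteq X$ is the extension of $\rho\in\mathsf{Pos}(V)$. A positive one-step formula is an element of $\mathsf{Pos}(\Lambda(\mathsf{Pos}(V)))$, with $(X,\tau,t)\models\heartsuit\rho$ iff $t\models\heartsuit[\![\rho]\!]_\tau$, Boolean connectives as expected (infinite disjunctions interpreted as unions).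 $\phi\sqsubseteq_1\psi$ means every one-step model over $V$ satisfying $\phi$ satisfies $\psi$. -}

module Defs where

open import Level using (Level; 0ℓ) renaming (suc to lsuc)
open import Data.Product using (Σ; _×_; _,_; ∃)
open import Data.Sum using (_⊎_)
open import Data.Unit using (⊤)
open import Data.Empty using (⊥)
open import Function using (id; _∘_)
open import Function.Definitions using (Injective)
open import Relation.Binary.PropositionalEquality using (_≡_)

_⊆_ : {X : Set} → (X → Set) → (X → Set) → Set
A ⊆ B = ∀ x → A x → B x

_⟺_ : ∀ {a b} → Set a → Set b → Set (a Level.⊔ b)
P ⟺ Q = (P → Q) × (Q → P)

record SetFunctor : Set₁ where
  field
    T      : Set → Set
    fmap   : {X Y : Set} → (X → Y) → T X → T Y
    fmap-id : {X : Set} (t : T X) → fmap id t ≡ t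
    fmap-∘  : {X Y Z : Set} (f : X → Y) (g : Y → Z) (t : T X) →
              fmap (g ∘ f) t ≡ fmap g (fmap f t)
    nontrivial : {X : Set} → X → T X
    preserves-inj : {X Y : Set} (f : X → Y) →
                    Injective _≡_ _≡_ f → Injective _≡_ _≡_ (fmap f)

record Similarity (F : SetFunctor) : Set₁ where
  open SetFunctor F
  field
    Λ      : Set
    lift   : Λ → {X : Set} → (X → Set) → (T X → Set)
    natural : (♡ : Λ) {X Y : Set} (f : X → Y) (A : Y → Set) (t : T X) →
              lift ♡ (A ∘ f) t ⟺ lift ♡ A (fmap f t)
    monotone : (♡ : Λ) {X : Set} (A B : X → Set) →
               A ⊆ B → lift ♡ A ⊆ lift ♡ B

data Pos (Z : Set) : Set where
  var  : Z → Pos Z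
  ⊤'   : Pos Z
  ⊥'   : Pos Z
  _∧'_ : Pos Z → Pos Z → Pos Z
  _∨'_ : Pos Z → Pos Z → Pos Z

⟦_⟧P : {Z : Set} → Pos Z → (Z → Set) → Set
⟦ var z ⟧P v = v z
⟦ ⊤' ⟧P v = ⊤
⟦ ⊥' ⟧P v = ⊥
⟦ a ∧' b ⟧P v = ⟦ a ⟧P v × ⟦ b ⟧P v
⟦ a ∨' b ⟧P v = ⟦ a ⟧P v ⊎ ⟦ b ⟧P v

module OneStep {F : SetFunctor} (S : Similarity F) where
  open SetFunctor F
  open Similarity S

  record Model (V : Set) : Set₁ where
    constructor model
    field
      X : Set
      τ : V → X → Set
      t : T X

  ext : {V X : Set} → (V → X → Set) → Pos V → X → Set
  ext τ ρ x = ⟦ ρ ⟧P (λ v → τ v x)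

  Atom : Set → Set
  Atom V = Λ × Pos V

  Formula : Set → Set
  Formula V = Pos (Atom V)

  _⊨a_ : {V : Set} → Model V → Atom V → Set
  model X τ t ⊨a (♡ , ρ) = lift ♡ (ext τ ρ) t

  _⊨_ : {V : Set} → Model V → Formula V → Set
  M ⊨ φ = ⟦ φ ⟧P (M ⊨a_)

  _⊑₁_ : {V : Set} → Formula V → Formula V → Set₁
  _⊑₁_ {V} φ ψ = (M : Model V) → M ⊨ φ → M ⊨ ψ

  -- φ ⊑₁ ⋁_{i ∈ I} ψ i  (infinite disjunction interpreted as union)
  _⊑₁⋁_ : {V I : Set} → Formula V → (I → Formula V) → Set₁
  _⊑₁⋁_ {V} {I} φ ψ = (M : Model V) → M ⊨ φ → Σ I (λ i → M ⊨ ψ i)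

  Materializable : {V : Set} → Formula V → Set₁
  Materializable {V} φ =
    Σ (Model V) λ M →
      ((♡ : Λ) (ρ : Pos V) → (M ⊨ var (♡ , ρ)) ⟺ (φ ⊑₁ var (♡ , ρ)))
      × (M ⊨ φ)

  Satisfiable : {V : Set} → Formula V → Set₁
  Satisfiable {V} φ = Σ (Model V) λ M → M ⊨ φ

  StronglyConvex : {V : Set} → Formula V → Set₁
  StronglyConvex {V} φ =
    Satisfiable φ ×
    ((I : Set) (ψ : I → Formula V) → φ ⊑₁⋁ ψ → Σ I (λ i → φ ⊑₁ ψ i))

module Submission where

-- Call a model M of φ *exact* if every modal atom ♡ρ true in M is already
-- entailed by φ.  Since the converse (entailed atoms hold in every model of φ)
-- is automatic, φ is materializable iff it has an exact model.
--
-- (⇒) In an exact model every positive formula ψ that holds is entailed by φ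
--     (induction on ψ, using that ψ has no negation).  Given φ ⊑₁ ⋁ᵢ ψᵢ, the
--     exact model satisfies some ψᵢ, hence φ ⊑₁ ψᵢ.
-- (⇐) Classically, every model of φ is either exact or satisfies an atom not
--     entailed by φ.  If φ had no exact model, φ would entail the disjunction
--     of all non-entailed atoms; strong convexity would then make φ entail one
--     of them, a contradiction.  Excluded middle is used for this dichotomy
--     and to conclude materializability from the impossibility of its failure.

open import Defs
open import Axiom.ExcludedMiddle using (ExcludedMiddle)
open import Level using (0ℓ) renaming (suc to lsuc)
open import Data.Product using (Σ; _,_; proj₁)
open import Data.Sum using (inj₁; inj₂)
open import Data.Unit using (tt)
open import Data.Empty using (⊥-elim)
open import Relation.Nullary using (yes; no; ¬_)
open import Relation.Nullary.Decidable using (does; decidable-stable; dec-true; dec-false)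
open import Data.Bool using (Bool; true; false)
open import Relation.Binary.PropositionalEquality using (_≡_; _≢_; sym; trans)

module Materialization {F : SetFunctor} (S : Similarity F) {V : Set} where
  open OneStep S

  Exact : Formula V → Model V → Set₁
  Exact φ M = (a : Atom V) → M ⊨ var a → φ ⊑₁ var a

  exact-entails : (φ : Formula V) (M : Model V) → Exact φ M →
                  (ψ : Formula V) → M ⊨ ψ → φ ⊑₁ ψ
  exact-entails φ M ex (var a)  Mψ        = ex a Mψ
  exact-entails φ M ex ⊤'       _         = λ _ _ → tt
  exact-entails φ M ex ⊥'       ()
  exact-entails φ M ex (ψ ∧' χ) (Mψ , Mχ) N Nφ =
    exact-entails φ M ex ψ Mψ N Nφ , exact-entails φ M ex χ Mχ N Nφ
  exact-entails φ M ex (ψ ∨' χ) (inj₁ Mψ) N Nφ = inj₁ (exact-entails φ M ex ψ Mψ N Nφ)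
  exact-entails φ M ex (ψ ∨' χ) (inj₂ Mχ) N Nφ = inj₂ (exact-entails φ M ex χ Mχ N Nφ)

  -- An exact model of φ materializes φ: atoms entailed by φ hold in any
  -- model of φ, so exactness is exactly the missing direction.
  exact-materializes : (φ : Formula V) (M : Model V) →
                       M ⊨ φ → Exact φ M → Materializable φ
  exact-materializes φ M Mφ ex =
    M , (λ ♡ ρ → ex (♡ , ρ) , λ φ⊑♡ρ → φ⊑♡ρ M Mφ) , Mφ

  materializing-exact : (φ : Formula V) (m : Materializable φ) →
                        Exact φ (proj₁ m)
  materializing-exact φ (M , faithful , _) (♡ , ρ) = proj₁ (faithful ♡ ρ)

  materializable⇒convex : (φ : Formula V) → Materializable φ → StronglyConvex φ
  materializable⇒convex φ m@(M , _ , Mφ) = (M , Mφ) , convex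
    where
      convex : (I : Set) (ψ : I → Formula V) → φ ⊑₁⋁ ψ → Σ I (λ i → φ ⊑₁ ψ i)
      convex I ψ φ⊑⋁ψ =
        let (i , Mψᵢ) = φ⊑⋁ψ M Mφ
        in  i , exact-entails φ M (materializing-exact φ m) (ψ i) Mψᵢ

  module Classical (lem : ∀ {ℓ} → ExcludedMiddle ℓ) (φ : Formula V) where

    -- Recording only the
    -- Boolean verdict keeps the set of non-entailed atoms small (in Set), as
    -- required of the index sets in the definition of strong convexity.
    entails? : Atom V → Bool
    entails? a = does (lem {lsuc 0ℓ} {φ ⊑₁ var a})

    NonEntailed : Set
    NonEntailed = Σ (Atom V) λ a → entails? a ≡ false

    non-entailed : ((a , _) : NonEntailed) → ¬ (φ ⊑₁ var a)
    non-entailed (a , rejected) φ⊑a =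
      true≢false (trans (sym (dec-true lem φ⊑a)) rejected)
      where true≢false : true ≢ false
            true≢false ()

    exact-or-escapes : (M : Model V) →
                       ¬ Exact φ M → Σ NonEntailed (λ n → M ⊨ var (proj₁ n))
    exact-or-escapes M ¬ex with lem {0ℓ} {Σ NonEntailed (λ n → M ⊨ var (proj₁ n))}
    ... | yes escape = escape
    ... | no  ¬escape = ⊥-elim (¬ex λ a Ma →
            decidable-stable lem λ ¬φ⊑a → ¬escape ((a , dec-false lem ¬φ⊑a) , Ma))

    covered-by-non-entailed : ¬ Materializable φ →
                              φ ⊑₁⋁ (λ (n : NonEntailed) → var (proj₁ n))
    covered-by-non-entailed ¬mat M Mφ =
      exact-or-escapes M (λ ex → ¬mat (exact-materializes φ M Mφ ex))

    convex⇒materializable : StronglyConvex φ → Materializable φ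
    convex⇒materializable (_ , convex) = decidable-stable lem λ ¬mat →
      let (n , φ⊑n) = convex NonEntailed (λ n → var (proj₁ n))
                             (covered-by-non-entailed ¬mat)
      in  non-entailed n φ⊑n

lemma4p16 : (lem : ∀ {ℓ} → ExcludedMiddle ℓ)
            (F : SetFunctor) (S : Similarity F) (V : Set)
            (φ : OneStep.Formula S V) →
            OneStep.Materializable S φ ⟺ OneStep.StronglyConvex S φ
lemma4p16 lem F S V φ =
  materializable⇒convex φ , Classical.convex⇒materializable lem φ
  where open Materialization S
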